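{- The sequence $s_{3/2}=(s_{3/2}(N))_{N\ge0}$ is the fixed point starting with $0$ of the $2$-$3$-block substitution on the alphabet $\{0,1,2,\dots\}$ given by $$a\,b \mapsto a,\ a+1,\ a+2 \qquad \text{for all } a,b\in\{0,1,2,\dots\}.$$
   Context: Every natural number $N$ can be written uniquely (ignoring leading zeros) as $N=\sum_{i=0}^{R} d_i (3/2)^i$ with digits $d_i\in\{0,1,2\}$; this is the base $3/2$ representation of $N$, and $s_{3/2}(N)=\sum_{i=0}^R d_i$ (with $s_{3/2}(0)=0$). A $2$-$3$-block substitution $\kappa$ on a (possibly infinite) alphabet $A$ assigns to each word $ab$ of length 2 over $A$ a word $\kappa(ab)$ of length 3; it acts on an infinite sequence $x=x_0x_1x_2\dots$ by $\kappa(x)=y$ where $y_{3k}y_{3k+1}y_{3k+2}=\kappa(x_{2k}x_{2k+1})$ for $k\ge0$. A fixed point of $\kappa$ is a sequence $x$ with $\kappa(x)=x$. -}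

module Defs where

open import Data.Nat using (ℕ; zero; suc; _+_; _*_)
open import Data.Nat.DivMod using (_/_; _mod_)
open import Data.Fin using (Fin; toℕ)
open import Data.List using (List; []; _∷_; map)
open import Data.Nat.ListAction using (sum)
open import Data.Integer using (+_)
import Data.Rational as ℚ
open import Data.Rational using (ℚ)
open import Relation.Binary.PropositionalEquality using (_≡_)

-- value of a digit list d₀ d₁ … d_R (lowest digit first) in base 3/2:
--   ∑ dᵢ (3/2)^i , computed by Horner's scheme in ℚ
val32 : List (Fin 3) → ℚ
val32 []       = ℚ.0ℚ
val32 (d ∷ ds) = ℚ._+_ (+ (toℕ d) ℚ./ 1) (ℚ._*_ (+ 3 ℚ./ 2) (val32 ds))

-- ds is a base-3/2 representation of N (leading zeros allowed; they do
-- not affect the digit sum)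
IsRep32 : ℕ → List (Fin 3) → Set
IsRep32 N ds = val32 ds ≡ (+ N ℚ./ 1)

digitSum : List (Fin 3) → ℕ
digitSum ds = sum (map toℕ ds)

-- a 2-3-block substitution on alphabet A: assigns to each length-2 word ab
-- a length-3 word, given as a function Fin 3 → A
BlockSub23 : Set → Set
BlockSub23 A = A → A → Fin 3 → A

applySub : {A : Set} → BlockSub23 A → (ℕ → A) → (ℕ → A)
applySub κ x n = κ (x (2 * (n / 3))) (x (2 * (n / 3) + 1)) (n mod 3)

IsFixedPoint : {A : Set} → BlockSub23 A → (ℕ → A) → Set
IsFixedPoint κ x = ∀ n → applySub κ x n ≡ x n

κ32 : BlockSub23 ℕ
κ32 a b j = a + toℕ j

{-# OPTIONS --safe #-}
-- Write n = j + 3k with j = n mod 3. Since j + (3/2)·2k = n, prefixing any base-3/2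
-- representation of 2k with the digit j gives one of n, so s(n) = s(2k) + j. That is
-- exactly the fixed-point equation, because position n lies in the block κ(s(2k) s(2k+1))
-- at offset j. Representations exist for every n by strong induction, as 2k < n for n > 0.
module Submission where

open import Defs
open import Data.Nat as ℕ using (ℕ; zero; suc; _+_; _*_; _<_; NonZero; z≤n; s≤s)
import Data.Nat.Properties as ℕ
import Data.Nat.Coprimality as Coprime
open import Data.Nat.DivMod using (_/_; _mod_; _divMod_; DivMod)
open import Data.Nat.Induction using (<-rec)
open import Data.Fin using (Fin; toℕ)
open import Data.List using (List; []; _∷_)
open import Data.Product using (_×_; ∃; _,_)
open import Data.Integer as ℤ using (+_)
import Data.Integer.Properties as ℤ
open import Data.Rational as ℚ using (ℚ; mkℚ)
import Data.Rational.Properties as ℚ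
open import Relation.Binary.PropositionalEquality using (_≡_; refl; sym; trans; cong; cong₂; subst; module ≡-Reasoning)
open ≡-Reasoning

toℚ : ℕ → ℚ
toℚ n = + n ℚ./ 1

toℚ≡mkℚ : ∀ n → toℚ n ≡ mkℚ (+ n) 0 (Coprime.sym (Coprime.1-coprimeTo n))
toℚ≡mkℚ n = ℚ.normalize-coprime (Coprime.sym (Coprime.1-coprimeTo n))

toℚ-homo-+ : ∀ m n → toℚ (m + n) ≡ toℚ m ℚ.+ toℚ n
toℚ-homo-+ m n = begin
  (+ m ℤ.+ + n) ℚ./ 1                   ≡⟨ cong (ℚ._/ 1) (cong₂ ℤ._+_ (ℤ.*-identityʳ (+ m)) (ℤ.*-identityʳ (+ n))) ⟨
  (+ m ℤ.* + 1 ℤ.+ + n ℤ.* + 1) ℚ./ 1   ≡⟨ cong₂ ℚ._+_ (toℚ≡mkℚ m) (toℚ≡mkℚ n) ⟨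
  toℚ m ℚ.+ toℚ n                       ∎

toℚ-homo-* : ∀ m n → toℚ (m * n) ≡ toℚ m ℚ.* toℚ n
toℚ-homo-* m n = begin
  + (m * n) ℚ./ 1       ≡⟨ cong (ℚ._/ 1) (ℤ.pos-* m n) ⟩
  (+ m ℤ.* + n) ℚ./ 1   ≡⟨ cong₂ ℚ._*_ (toℚ≡mkℚ m) (toℚ≡mkℚ n) ⟨
  toℚ m ℚ.* toℚ n       ∎

three-halves-of-double : ∀ k → (+ 3 ℚ./ 2) ℚ.* toℚ (2 * k) ≡ toℚ (3 * k)
three-halves-of-double k = begin
  (+ 3 ℚ./ 2) ℚ.* toℚ (2 * k)         ≡⟨ cong ((+ 3 ℚ./ 2) ℚ.*_) (toℚ-homo-* 2 k) ⟩
  (+ 3 ℚ./ 2) ℚ.* (toℚ 2 ℚ.* toℚ k)   ≡⟨ ℚ.*-assoc (+ 3 ℚ./ 2) (toℚ 2) (toℚ k) ⟨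
  ((+ 3 ℚ./ 2) ℚ.* toℚ 2) ℚ.* toℚ k   ≡⟨⟩
  toℚ 3 ℚ.* toℚ k                     ≡⟨ toℚ-homo-* 3 k ⟨
  toℚ (3 * k)                         ∎

IsRep32-∷ : ∀ (j : Fin 3) k ds → IsRep32 (2 * k) ds → IsRep32 (toℕ j + 3 * k) (j ∷ ds)
IsRep32-∷ j k ds rep = begin
  toℚ (toℕ j) ℚ.+ (+ 3 ℚ./ 2) ℚ.* val32 ds      ≡⟨ cong (λ v → toℚ (toℕ j) ℚ.+ (+ 3 ℚ./ 2) ℚ.* v) rep ⟩
  toℚ (toℕ j) ℚ.+ (+ 3 ℚ./ 2) ℚ.* toℚ (2 * k)   ≡⟨ cong (toℚ (toℕ j) ℚ.+_) (three-halves-of-double k) ⟩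
  toℚ (toℕ j) ℚ.+ toℚ (3 * k)                   ≡⟨ toℚ-homo-+ (toℕ j) (3 * k) ⟨
  toℚ (toℕ j + 3 * k)                           ∎

n≡n%3+3*[n/3] : ∀ n → n ≡ toℕ (n mod 3) + 3 * (n / 3)
n≡n%3+3*[n/3] n = trans (DivMod.property (n divMod 3))
                        (cong (λ q → toℕ (n mod 3) + q) (ℕ.*-comm (n / 3) 3))

IsRep32-mod3∷ : ∀ n ds → IsRep32 (2 * (n / 3)) ds → IsRep32 n (n mod 3 ∷ ds)
IsRep32-mod3∷ n ds rep =
  subst (λ m → IsRep32 m (n mod 3 ∷ ds)) (sym (n≡n%3+3*[n/3] n))
        (IsRep32-∷ (n mod 3) (n / 3) ds rep)

2*k<j+3*k : ∀ j k → 0 < j + 3 * k → 2 * k < j + 3 * k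
2*k<j+3*k j zero    0<j = 0<j
2*k<j+3*k j (suc k) _   = ℕ.<-≤-trans (ℕ.m<n+m (2 * suc k) (s≤s z≤n)) (ℕ.m≤n+m (3 * suc k) j)

2*[n/3]<n : ∀ n .{{_ : NonZero n}} → 2 * (n / 3) < n
2*[n/3]<n n = subst (2 * (n / 3) <_) (sym n≡j+3k)
  (2*k<j+3*k (toℕ (n mod 3)) (n / 3) (subst (0 <_) n≡j+3k (ℕ.>-nonZero⁻¹ n)))
  where
  n≡j+3k : n ≡ toℕ (n mod 3) + 3 * (n / 3)
  n≡j+3k = n≡n%3+3*[n/3] n

rep32 : ∀ n → ∃ (IsRep32 n)
rep32 = <-rec (λ n → ∃ (IsRep32 n)) step
  where
  step : ∀ n → (∀ {m} → m < n → ∃ (IsRep32 m)) → ∃ (IsRep32 n)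
  step zero      _   = [] , refl
  step n@(suc _) rec with rec (2*[n/3]<n n)
  ... | ds , rep = n mod 3 ∷ ds , IsRep32-mod3∷ n ds rep

theorem2 : (s : ℕ → ℕ)
    → (∀ (N : ℕ) (ds : List (Fin 3)) → IsRep32 N ds → s N ≡ digitSum ds)
    → (s 0 ≡ 0) × IsFixedPoint κ32 s
theorem2 s s≡digitSum = s≡digitSum 0 [] refl , fixed
  where
  fixed : IsFixedPoint κ32 s
  fixed n with rep32 (2 * (n / 3))
  ... | ds , rep = begin
    s (2 * (n / 3)) + toℕ (n mod 3)   ≡⟨ cong (_+ toℕ (n mod 3)) (s≡digitSum _ ds rep) ⟩
    digitSum ds + toℕ (n mod 3)       ≡⟨ ℕ.+-comm (digitSum ds) (toℕ (n mod 3)) ⟩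
    digitSum (n mod 3 ∷ ds)           ≡⟨ s≡digitSum n (n mod 3 ∷ ds) (IsRep32-mod3∷ n ds rep) ⟨
    s n                               ∎
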